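{- For any two connected graphs $H$ and $G$, $$\chi^L_{G}(H)\leq\left\lceil \frac{\Delta(H)}{\delta(G)}\right\rceil+1.$$
   Context: All graphs are finite, simple and undirected. $\Delta(H)$ is the maximum degree of $H$ and $\delta(G)$ the minimum degree of $G$. $H$ is $G$-free if $H$ contains no subgraph isomorphic to $G$. A list assignment $L$ of $H$ assigns to each vertex $v$ a set $L(v)$ of colors; an $L$-$G$-free coloring is a map $c$ with $c(v)\in L(v)$ for all $v$ such that each color class induces a $G$-free subgraph of $H$. $H$ is $k$-$G$-free-choosable if it has an $L$-$G$-free coloring for every list assignment $L$ with $|L(v)|\ge k$ for all $v$; $\chi_G^L(H)$ is the least such $k$. -}

module Defs where

open import Data.Nat using (ℕ; zero; suc; _+_; _*_; _≤_; _⊔_; _⊓_)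
open import Data.Nat.DivMod using (_/_)
open import Data.Fin using (Fin)
open import Data.List using (List; []; _∷_; length; filter; map; foldr; allFin)
open import Data.List.Membership.Propositional using (_∈_)
open import Data.List.Relation.Unary.Unique.Propositional using (Unique)
open import Data.Product using (Σ; _×_)
open import Relation.Binary.PropositionalEquality using (_≡_)
open import Relation.Binary using (Rel; Decidable; Symmetric; Irreflexive)
open import Relation.Nullary using (¬_)
open import Function.Definitions using (Injective)

record Graph (n : ℕ) : Set₁ where
  field
    Adj    : Rel (Fin n) _
    adj?   : Decidable Adj
    sym    : Symmetric Adj
    irrefl : Irreflexive _≡_ Adj
open Graph public

deg : ∀ {n} → Graph n → Fin n → ℕ
deg {n} H v = length (filter (adj? H v) (allFin n))

Δ : ∀ {n} → Graph n → ℕ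
Δ {n} H = foldr _⊔_ 0 (map (deg H) (allFin n))

-- minimum degree δ (0 for the empty graph, by convention)
δ : ∀ {n} → Graph n → ℕ
δ {zero}  G = 0
δ {suc n} G = foldr _⊓_ (deg G Fin.zero) (map (deg G) (allFin (suc n)))

data Reachable {n} (H : Graph n) : Fin n → Fin n → Set where
  here  : ∀ {u} → Reachable H u u
  step  : ∀ {u v w} → Adj H u v → Reachable H v w → Reachable H u w

Connected : ∀ {n} → Graph n → Set
Connected {n} H = (u v : Fin n) → Reachable H u v

-- ceiling division ⌈ a / b ⌉ (junk value 0 when b = 0)
⌈_/_⌉ : ℕ → ℕ → ℕ
⌈ a / zero ⌉  = 0
⌈ a / suc b ⌉ = (a + b) / suc b

Colour : Set
Colour = ℕ

-- A copy of G inside H all of whose vertices receive colour col under c: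
-- an injective map V(G) → V(H) preserving adjacency, with image in the
-- colour class of col.  (Subgraph of the induced subgraph H[c⁻¹(col)].)
MonoCopy : ∀ {m n} → Graph m → Graph n → (Fin n → Colour) → Colour → Set
MonoCopy {m} {n} G H c col =
  Σ (Fin m → Fin n) λ f →
    Injective _≡_ _≡_ f
    × (∀ u v → Adj G u v → Adj H (f u) (f v))
    × (∀ u → c (f u) ≡ col)

GFreeColouring : ∀ {m n} → Graph m → Graph n → (Fin n → Colour) → Set
GFreeColouring G H c = ∀ col → ¬ MonoCopy G H c col

-- list assignments; a list L v represents the set of its entries
ListAssignment : ℕ → Set
ListAssignment n = Fin n → List Colour

LGFreeColouring : ∀ {m n} → Graph m → Graph n → ListAssignment n → Set
LGFreeColouring G H L =
  Σ (_ → Colour) λ c → (∀ v → c v ∈ L v) × GFreeColouring G H c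

-- H is k-G-free-choosable: every L with |L(v)| ≥ k (lists without repetition,
-- i.e. genuine sets of colours) admits an L-G-free colouring.
Choosable : ∀ {m n} → Graph m → Graph n → ℕ → Set
Choosable {n = n} G H k =
  (L : ListAssignment n) →
  (∀ v → Unique (L v)) →
  (∀ v → k ≤ length (L v)) →
  LGFreeColouring G H L

-- Among the L-colourings of H take one with fewest monochromatic edges.  If some
-- vertex v had at least δ(G) neighbours of its own colour, then, since v has
-- at most Δ(H) < (⌈Δ(H)/δ(G)⌉ + 1)·δ(G) ≤ |L(v)|·δ(G) neighbours, some colour of
-- L(v) occurs on fewer neighbours of v than the colour of v does, and recolouring
-- v with it destroys more monochromatic edges than it creates.  So in an optimal
-- colouring every vertex has fewer than δ(G) neighbours of its colour, whereas the
-- image of any vertex of a monochromatic copy of G has at least δ(G) of them.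
module Submission where

open import Defs hiding (sym)
import Algebra.Properties.Semiring.Sum as Sum
open import Data.Bool using (true; false; if_then_else_)
open import Data.Fin using (Fin) renaming (zero to fzero; suc to fsuc)
open import Data.Fin.Properties using (suc-injective) renaming (_≟_ to _≟ᶠ_; any? to anyᶠ?)
open import Data.List using (List; []; _∷_; length; filter; allFin; tabulate)
open import Data.List.Membership.Propositional using (_∈_; find)
open import Data.List.Membership.Propositional.Properties using (∈-allFin; ∈-map⁺; ∈-filter⁺)
open import Data.List.Properties using (foldr-preservesᵇ; foldr-preservesᵒ)
open import Data.List.Relation.Unary.All using (All; []; _∷_)
import Data.List.Relation.Unary.All as All
open import Data.List.Relation.Unary.All.Properties using (¬Any⇒All¬; All¬⇒¬Any; tabulate⁺)
import Data.List.Relation.Unary.All.Properties as All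
open import Data.List.Relation.Unary.Any using (here; any?)
import Data.List.Relation.Unary.Any as Any
open import Data.List.Relation.Unary.Unique.Propositional using (Unique)
open import Data.List.Relation.Unary.AllPairs using (_∷_)
open import Data.Nat using (ℕ; zero; suc; _+_; _*_; _/_; _≤_; _<_; z≤n; s≤s; z<s; _≟_; _≤?_; _<?_)
open import Data.Nat.DivMod using (m*n/n≡m; /-monoˡ-≤)
open import Data.Nat.Induction using (<-wellFounded)
open import Data.Nat.Properties
  using ( +-*-semiring; +-comm; +-identityʳ; *-identityˡ; *-identityʳ; *-distribʳ-+
        ; ≤-refl; ≤-reflexive; ≤-trans; ≤-antisym; <-irrefl; ≰⇒>; ≮⇒≥; <⇒≱
        ; +-mono-≤; +-mono-<; +-monoʳ-<; +-cancelʳ-<; *-mono-≤; m≤m+n; m≤n+m; m<m+n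
        ; m≤n⇒m≤n⊔o; m≤n⇒m≤o⊔n; m≤n⇒m⊓o≤n; m≤n⇒o⊓m≤n; ⊓-glb
        ; module ≤-Reasoning )
open import Data.Product using (∃; ∃-syntax; _×_; _,_; proj₁; proj₂)
import Data.Product as Product
open import Data.Sum using (_⊎_; inj₁; inj₂; [_,_])
open import Data.Vec.Functional using (updateAt)
open import Data.Vec.Functional.Properties using (updateAt-updates; updateAt-minimal)
open import Function using (_∘_; const)
open import Function.Definitions using (Injective)
open import Induction.WellFounded using (Acc; acc)
open import Relation.Binary.PropositionalEquality
  using (_≡_; _≢_; refl; sym; trans; cong; cong₂; subst; module ≡-Reasoning)
open import Relation.Nullary using (¬_; Dec; does; yes; no; contradiction)
open import Relation.Nullary.Decidable using (_×-dec_; _⊎-dec_; ¬?)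
open import Relation.Unary using (Pred; Decidable)

open Sum +-*-semiring using (sum-syntax; sum-cong-≗; ∑-distrib-+; *-distribˡ-sum; sum-replicate-zero)
open import Data.List.Membership.DecPropositional _≟_ using (_∈?_)

indicator : ∀ {p} {P : Set p} → Dec P → ℕ
indicator p? = if does p? then 1 else 0

indicator-mono : ∀ {p q} {P : Set p} {Q : Set q} →
  (P → Q) → (p? : Dec P) (q? : Dec Q) → indicator p? ≤ indicator q?
indicator-mono P⇒Q (yes p) (yes _) = ≤-refl
indicator-mono P⇒Q (yes p) (no ¬q) = contradiction (P⇒Q p) ¬q
indicator-mono P⇒Q (no _)  _       = z≤n

module _ {p q} {P : Set p} {Q : Set q} where

  indicator-cong : (P → Q) → (Q → P) → (p? : Dec P) (q? : Dec Q) → indicator p? ≡ indicator q?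
  indicator-cong P⇒Q Q⇒P p? q? = ≤-antisym (indicator-mono P⇒Q p? q?) (indicator-mono Q⇒P q? p?)

  indicator-⊎ : ¬ (P × Q) → (p? : Dec P) (q? : Dec Q) →
    indicator p? + indicator q? ≡ indicator (p? ⊎-dec q?)
  indicator-⊎ disjoint (yes p) (yes q) = contradiction (p , q) disjoint
  indicator-⊎ disjoint (yes _) (no _)  = refl
  indicator-⊎ disjoint (no _)  (yes _) = refl
  indicator-⊎ disjoint (no _)  (no _)  = refl

∑-select : ∀ {n} (v : Fin n) (f : Fin n → ℕ) → ∑[ i < n ] (indicator (i ≟ᶠ v) * f i) ≡ f v
∑-select {suc n} fzero    f =
  trans (cong (f fzero + 0 +_) (sum-replicate-zero n)) (trans (+-identityʳ _) (+-identityʳ _))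
∑-select {suc n} (fsuc v) f = ∑-select {n} v (f ∘ fsuc)

∑∑-distrib-+ : ∀ {n} (F G : Fin n → Fin n → ℕ) →
  ∑[ w < n ] ∑[ u < n ] (F w u + G w u) ≡ ∑[ w < n ] ∑[ u < n ] F w u + ∑[ w < n ] ∑[ u < n ] G w u
∑∑-distrib-+ {n} F G = begin
  ∑[ w < n ] ∑[ u < n ] (F w u + G w u)
    ≡⟨ sum-cong-≗ (λ w → ∑-distrib-+ (F w) (G w)) ⟩
  ∑[ w < n ] (∑[ u < n ] F w u + ∑[ u < n ] G w u)
    ≡⟨ ∑-distrib-+ (λ w → ∑[ u < n ] F w u) (λ w → ∑[ u < n ] G w u) ⟩
  ∑[ w < n ] ∑[ u < n ] F w u + ∑[ w < n ] ∑[ u < n ] G w u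
    ∎
  where open ≡-Reasoning

count : ∀ {n p} {P : Pred (Fin n) p} → Decidable P → ℕ
count {n} P? = ∑[ i < n ] indicator (P? i)

_without_ : ∀ {n q} {Q : Pred (Fin n) q} → Decidable Q → (y₀ : Fin n) → Decidable (λ y → Q y × y ≢ y₀)
(Q? without y₀) y = Q? y ×-dec ¬? (y ≟ᶠ y₀)

length-filter-tabulate : ∀ {a p} {A : Set a} {P : Pred A p} (P? : Decidable P) {n} (f : Fin n → A) →
  length (filter P? (tabulate f)) ≡ ∑[ i < n ] indicator (P? (f i))
length-filter-tabulate P? {zero}  f = refl
length-filter-tabulate P? {suc n} f with does (P? (f fzero))
... | true  = cong suc (length-filter-tabulate P? (f ∘ fsuc))
... | false = length-filter-tabulate P? (f ∘ fsuc)

length-filter-allFin : ∀ {n p} {P : Pred (Fin n) p} (P? : Decidable P) →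
  length (filter P? (allFin n)) ≡ count P?
length-filter-allFin P? = length-filter-tabulate P? (λ i → i)

suc-count-without : ∀ {n q} {Q : Pred (Fin n) q} (Q? : Decidable Q) {y₀ : Fin n} → Q y₀ →
  suc (count (Q? without y₀)) ≡ count Q?
suc-count-without {n} {Q = Q} Q? {y₀} Qy₀ = begin
  suc (count (Q? without y₀))
    ≡⟨ +-comm 1 _ ⟩
  count (Q? without y₀) + 1
    ≡⟨ cong (count (Q? without y₀) +_) (∑-select y₀ (const 1)) ⟨
  count (Q? without y₀) + ∑[ y < n ] (indicator (y ≟ᶠ y₀) * 1)
    ≡⟨ ∑-distrib-+ (indicator ∘ (Q? without y₀)) (λ y → indicator (y ≟ᶠ y₀) * 1) ⟨
  ∑[ y < n ] (indicator ((Q? without y₀) y) + indicator (y ≟ᶠ y₀) * 1)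
    ≡⟨ sum-cong-≗ split ⟩
  count Q?
    ∎
  where
  open ≡-Reasoning
  split : ∀ y → indicator ((Q? without y₀) y) + indicator (y ≟ᶠ y₀) * 1 ≡ indicator (Q? y)
  split y = begin
    indicator ((Q? without y₀) y) + indicator (y ≟ᶠ y₀) * 1
      ≡⟨ cong (indicator ((Q? without y₀) y) +_) (*-identityʳ _) ⟩
    indicator ((Q? without y₀) y) + indicator (y ≟ᶠ y₀)
      ≡⟨ indicator-⊎ (λ ((_ , y≢y₀) , y≡y₀) → y≢y₀ y≡y₀) ((Q? without y₀) y) (y ≟ᶠ y₀) ⟩
    indicator ((Q? without y₀) y ⊎-dec y ≟ᶠ y₀)
      ≡⟨ indicator-cong [ proj₁ , (λ { refl → Qy₀ }) ] cases ((Q? without y₀) y ⊎-dec y ≟ᶠ y₀) (Q? y) ⟩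
    indicator (Q? y)
      ∎
    where
    cases : Q y → (Q y × y ≢ y₀) ⊎ y ≡ y₀
    cases Qy with y ≟ᶠ y₀
    ... | yes y≡y₀ = inj₂ y≡y₀
    ... | no  y≢y₀ = inj₁ (Qy , y≢y₀)

injection⇒count≤count : ∀ {m n p q} {P : Pred (Fin m) p} {Q : Pred (Fin n) q}
  (P? : Decidable P) (Q? : Decidable Q) {f : Fin m → Fin n} →
  Injective _≡_ _≡_ f → (∀ {x} → P x → Q (f x)) → count P? ≤ count Q?
injection⇒count≤count {zero}  P? Q?     f-inj P⇒Q = z≤n
injection⇒count≤count {suc m} P? Q? {f} f-inj P⇒Q with P? fzero
... | no _   = injection⇒count≤count (P? ∘ fsuc) Q? (suc-injective ∘ f-inj) P⇒Q
... | yes P0 = begin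
  suc (count (P? ∘ fsuc))
    ≤⟨ s≤s (injection⇒count≤count (P? ∘ fsuc) (Q? without f fzero) (suc-injective ∘ f-inj)
                                    (λ Px → P⇒Q Px , (λ ()) ∘ f-inj)) ⟩
  suc (count (Q? without f fzero))
    ≡⟨ suc-count-without Q? (P⇒Q P0) ⟩
  count Q?
    ∎
  where open ≤-Reasoning

module _ {n} (v : Fin n) where

  incidences : Fin n → Fin n → ℕ
  incidences w u = indicator (w ≟ᶠ v) + indicator (u ≟ᶠ v)

  ∑∑-incidences : (F : Fin n → Fin n → ℕ) →
    ∑[ w < n ] ∑[ u < n ] (incidences w u * F w u) ≡ ∑[ u < n ] F v u + ∑[ w < n ] F w v
  ∑∑-incidences F = begin
    ∑[ w < n ] ∑[ u < n ] (incidences w u * F w u)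
      ≡⟨ sum-cong-≗ row ⟩
    ∑[ w < n ] (indicator (w ≟ᶠ v) * ∑[ u < n ] F w u + F w v)
      ≡⟨ ∑-distrib-+ (λ w → indicator (w ≟ᶠ v) * ∑[ u < n ] F w u) (λ w → F w v) ⟩
    ∑[ w < n ] (indicator (w ≟ᶠ v) * ∑[ u < n ] F w u) + ∑[ w < n ] F w v
      ≡⟨ cong (_+ ∑[ w < n ] F w v) (∑-select v (λ w → ∑[ u < n ] F w u)) ⟩
    ∑[ u < n ] F v u + ∑[ w < n ] F w v
      ∎
    where
    open ≡-Reasoning
    row : ∀ w → ∑[ u < n ] (incidences w u * F w u) ≡ indicator (w ≟ᶠ v) * ∑[ u < n ] F w u + F w v
    row w = begin
      ∑[ u < n ] (incidences w u * F w u)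
        ≡⟨ sum-cong-≗ (λ u → *-distribʳ-+ (F w u) (indicator (w ≟ᶠ v)) _) ⟩
      ∑[ u < n ] (indicator (w ≟ᶠ v) * F w u + indicator (u ≟ᶠ v) * F w u)
        ≡⟨ ∑-distrib-+ (λ u → indicator (w ≟ᶠ v) * F w u) (λ u → indicator (u ≟ᶠ v) * F w u) ⟩
      ∑[ u < n ] (indicator (w ≟ᶠ v) * F w u) + ∑[ u < n ] (indicator (u ≟ᶠ v) * F w u)
        ≡⟨ cong₂ _+_ (sym (*-distribˡ-sum (indicator (w ≟ᶠ v)) (F w))) (∑-select v (F w)) ⟩
      indicator (w ≟ᶠ v) * ∑[ u < n ] F w u + F w v
        ∎

  -- ∑∑ F′ − ∑∑ F is the change of the row-plus-column sum at v, stated without subtraction.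
  ∑∑-local-change : (F F′ : Fin n → Fin n → ℕ) →
    (∀ w u → w ≢ v → u ≢ v → F w u ≡ F′ w u) → F v v ≡ F′ v v →
    ∑[ w < n ] ∑[ u < n ] F′ w u + (∑[ u < n ] F v u + ∑[ w < n ] F w v) ≡
    ∑[ w < n ] ∑[ u < n ] F w u + (∑[ u < n ] F′ v u + ∑[ w < n ] F′ w v)
  ∑∑-local-change F F′ away diagonal = begin
    ∑∑ F′ + (∑[ u < n ] F v u + ∑[ w < n ] F w v)
      ≡⟨ cong (∑∑ F′ +_) (∑∑-incidences F) ⟨
    ∑∑ F′ + ∑∑ (λ w u → incidences w u * F w u)
      ≡⟨ ∑∑-distrib-+ F′ (λ w u → incidences w u * F w u) ⟨
    ∑∑ (λ w u → F′ w u + incidences w u * F w u)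
      ≡⟨ sum-cong-≗ (λ w → sum-cong-≗ (exchange w)) ⟩
    ∑∑ (λ w u → F w u + incidences w u * F′ w u)
      ≡⟨ ∑∑-distrib-+ F (λ w u → incidences w u * F′ w u) ⟩
    ∑∑ F + ∑∑ (λ w u → incidences w u * F′ w u)
      ≡⟨ cong (∑∑ F +_) (∑∑-incidences F′) ⟩
    ∑∑ F + (∑[ u < n ] F′ v u + ∑[ w < n ] F′ w v)
      ∎
    where
    open ≡-Reasoning
    ∑∑ : (Fin n → Fin n → ℕ) → ℕ
    ∑∑ G = ∑[ w < n ] ∑[ u < n ] G w u
    exchange-≡ : ∀ k {x x′} → x ≡ x′ → x′ + k * x ≡ x + k * x′
    exchange-≡ k refl = refl
    exchange-1 : ∀ x x′ → x′ + 1 * x ≡ x + 1 * x′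
    exchange-1 x x′ = begin
      x′ + 1 * x  ≡⟨ cong (x′ +_) (*-identityˡ x) ⟩
      x′ + x      ≡⟨ +-comm x′ x ⟩
      x + x′      ≡⟨ cong (x +_) (*-identityˡ x′) ⟨
      x + 1 * x′  ∎
    exchange : ∀ w u → F′ w u + incidences w u * F w u ≡ F w u + incidences w u * F′ w u
    exchange w u with w ≟ᶠ v | u ≟ᶠ v
    ... | yes refl | yes refl = exchange-≡ 2 diagonal
    ... | yes refl | no  _    = exchange-1 (F w u) (F′ w u)
    ... | no  _    | yes refl = exchange-1 (F w u) (F′ w u)
    ... | no  w≢v  | no  u≢v  = exchange-≡ 0 (away w u w≢v u≢v)

recolour : ∀ {n} → (Fin n → Colour) → Fin n → Colour → Fin n → Colour
recolour c v b = updateAt c v (const b)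

recolour-∈ : ∀ {n} (L : ListAssignment n) {c v b} →
  (∀ w → c w ∈ L w) → b ∈ L v → ∀ w → recolour c v b w ∈ L w
recolour-∈ L {c} {v} c∈L b∈L w with w ≟ᶠ v
... | yes refl = subst (_∈ L w) (sym (updateAt-updates w c)) b∈L
... | no  w≢v  = subst (_∈ L w) (sym (updateAt-minimal w v c w≢v)) (c∈L w)

module _ {n} (H : Graph n) where

  colourDegree : (Fin n → Colour) → Fin n → Colour → ℕ
  colourDegree c v a = count (λ u → adj? H v u ×-dec c u ≟ a)

  colourDegreeIn : (Fin n → Colour) → Fin n → List Colour → ℕ
  colourDegreeIn c v as = count (λ u → adj? H v u ×-dec c u ∈? as)

  monoDegree : (Fin n → Colour) → Fin n → ℕ
  monoDegree c v = colourDegree c v (c v)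

  monoDegreeSum : (Fin n → Colour) → ℕ
  monoDegreeSum c = ∑[ v < n ] monoDegree c v

  monoEdge : (Fin n → Colour) → Fin n → Fin n → ℕ
  monoEdge c w u = indicator (adj? H w u ×-dec c u ≟ c w)

  deg≡count : ∀ v → deg H v ≡ count (adj? H v)
  deg≡count v = length-filter-allFin (adj? H v)

  ∑-monoEdge-column : ∀ c v → ∑[ w < n ] monoEdge c w v ≡ monoDegree c v
  ∑-monoEdge-column c v = sum-cong-≗ λ w →
    indicator-cong (Product.map (Graph.sym H) sym) (Product.map (Graph.sym H) sym)
      (adj? H w v ×-dec c v ≟ c w) (adj? H v w ×-dec c w ≟ c v)

  monoDegree-recolour : ∀ c v b → monoDegree (recolour c v b) v ≡ colourDegree c v b
  monoDegree-recolour c v b = sum-cong-≗ λ u →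
    indicator-cong (λ (vu , e) → vu , trans (sym (unchanged vu)) (trans e (updateAt-updates v c)))
                   (λ (vu , e) → vu , trans (unchanged vu) (trans e (sym (updateAt-updates v c))))
                   (adj? H v u ×-dec c′ u ≟ c′ v) (adj? H v u ×-dec c u ≟ b)
    where
    c′ = recolour c v b
    unchanged : ∀ {u} → Adj H v u → c′ u ≡ c u
    unchanged vu = updateAt-minimal _ v c (λ u≡v → irrefl H (sym u≡v) vu)

  monoDegreeSum-recolour : ∀ c v b →
    monoDegreeSum (recolour c v b) + (monoDegree c v + monoDegree c v) ≡
    monoDegreeSum c + (colourDegree c v b + colourDegree c v b)
  monoDegreeSum-recolour c v b = begin
    monoDegreeSum c′ + (monoDegree c v + monoDegree c v)
      ≡⟨ cong (λ x → monoDegreeSum c′ + (monoDegree c v + x)) (∑-monoEdge-column c v) ⟨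
    monoDegreeSum c′ + (monoDegree c v + ∑[ w < n ] monoEdge c w v)
      ≡⟨ ∑∑-local-change v (monoEdge c) (monoEdge c′) away diagonal ⟩
    monoDegreeSum c + (monoDegree c′ v + ∑[ w < n ] monoEdge c′ w v)
      ≡⟨ cong (λ x → monoDegreeSum c + (monoDegree c′ v + x)) (∑-monoEdge-column c′ v) ⟩
    monoDegreeSum c + (monoDegree c′ v + monoDegree c′ v)
      ≡⟨ cong (λ x → monoDegreeSum c + (x + x)) (monoDegree-recolour c v b) ⟩
    monoDegreeSum c + (colourDegree c v b + colourDegree c v b)
      ∎
    where
    open ≡-Reasoning
    c′ = recolour c v b
    away : ∀ w u → w ≢ v → u ≢ v → monoEdge c w u ≡ monoEdge c′ w u
    away w u w≢v u≢v = indicator-cong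
      (Product.map₂ λ e → trans (updateAt-minimal u v c u≢v) (trans e (sym (updateAt-minimal w v c w≢v))))
      (Product.map₂ λ e → trans (sym (updateAt-minimal u v c u≢v)) (trans e (updateAt-minimal w v c w≢v)))
      (adj? H w u ×-dec c u ≟ c w) (adj? H w u ×-dec c′ u ≟ c′ w)
    diagonal : monoEdge c v v ≡ monoEdge c′ v v
    diagonal = indicator-cong (Product.map₂ (λ _ → refl)) (Product.map₂ (λ _ → refl))
      (adj? H v v ×-dec c v ≟ c v) (adj? H v v ×-dec c′ v ≟ c′ v)

  monoDegreeSum-recolour-< : ∀ c v b → colourDegree c v b < monoDegree c v →
    monoDegreeSum (recolour c v b) < monoDegreeSum c
  monoDegreeSum-recolour-< c v b rarer = +-cancelʳ-< (monoDegree c v + monoDegree c v) _ _ (begin-strict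
    monoDegreeSum (recolour c v b) + (monoDegree c v + monoDegree c v)
      ≡⟨ monoDegreeSum-recolour c v b ⟩
    monoDegreeSum c + (colourDegree c v b + colourDegree c v b)
      <⟨ +-monoʳ-< (monoDegreeSum c) (+-mono-< rarer rarer) ⟩
    monoDegreeSum c + (monoDegree c v + monoDegree c v)
      ∎)
    where open ≤-Reasoning

  length*≤colourDegreeIn : ∀ c v M {as} → Unique as → All (λ a → M ≤ colourDegree c v a) as →
    length as * M ≤ colourDegreeIn c v as
  length*≤colourDegreeIn c v M {[]}     _              _          = z≤n
  length*≤colourDegreeIn c v M {a ∷ as} (a∉as ∷ uniq) (M≤ ∷ M≤s) = begin
    M + length as * M
      ≤⟨ +-mono-≤ M≤ (length*≤colourDegreeIn c v M uniq M≤s) ⟩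
    colourDegree c v a + colourDegreeIn c v as
      ≡⟨ ∑-distrib-+ (λ u → indicator (adj? H v u ×-dec c u ≟ a))
                     (λ u → indicator (adj? H v u ×-dec c u ∈? as)) ⟨
    ∑[ u < n ] (indicator (adj? H v u ×-dec c u ≟ a) + indicator (adj? H v u ×-dec c u ∈? as))
      ≡⟨ sum-cong-≗ split ⟩
    colourDegreeIn c v (a ∷ as)
      ∎
    where
    open ≤-Reasoning
    split : ∀ u → indicator (adj? H v u ×-dec c u ≟ a) + indicator (adj? H v u ×-dec c u ∈? as) ≡
                  indicator (adj? H v u ×-dec c u ∈? (a ∷ as))
    split u with adj? H v u
    ... | no  _ = refl
    ... | yes _ = indicator-⊎ (λ { (refl , a∈as) → All¬⇒¬Any a∉as a∈as }) (c u ≟ a) (c u ∈? as)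

  length*≤deg : ∀ c v M {as} → Unique as → All (λ a → M ≤ colourDegree c v a) as →
    length as * M ≤ deg H v
  length*≤deg c v M {as} uniq M≤s = begin
    length as * M          ≤⟨ length*≤colourDegreeIn c v M uniq M≤s ⟩
    colourDegreeIn c v as  ≤⟨ injection⇒count≤count (λ u → adj? H v u ×-dec c u ∈? as) (adj? H v)
                                (λ u≡u′ → u≡u′) proj₁ ⟩
    count (adj? H v)       ≡⟨ deg≡count v ⟨
    deg H v                ∎
    where open ≤-Reasoning

  rarer-colour : ∀ c v {as} → Unique as → deg H v < length as * monoDegree c v →
    ∃[ b ] b ∈ as × colourDegree c v b < monoDegree c v
  rarer-colour c v {as} uniq deg< with any? (λ a → colourDegree c v a <? monoDegree c v) as
  ... | yes rarer = find rarer
  ... | no ¬rarer = contradiction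
    (length*≤deg c v (monoDegree c v) uniq (All.map ≮⇒≥ (¬Any⇒All¬ as ¬rarer))) (<⇒≱ deg<)

  L-colouring-with-monoDegree< : ∀ (L : ListAssignment n) D →
    (∀ c v → D ≤ monoDegree c v → ∃[ b ] b ∈ L v × colourDegree c v b < monoDegree c v) →
    ∀ c → (∀ v → c v ∈ L v) → ∃[ c′ ] (∀ v → c′ v ∈ L v) × (∀ v → monoDegree c′ v < D)
  L-colouring-with-monoDegree< L D rarer c c∈L = search c c∈L (<-wellFounded (monoDegreeSum c))
    where
    search : ∀ c → (∀ v → c v ∈ L v) → Acc _<_ (monoDegreeSum c) →
      ∃[ c′ ] (∀ v → c′ v ∈ L v) × (∀ v → monoDegree c′ v < D)
    search c c∈L (acc smaller) with anyᶠ? (λ v → D ≤? monoDegree c v)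
    ... | no  ¬crowded      = c , c∈L , λ v → ≰⇒> (¬crowded ∘ (v ,_))
    ... | yes (v , crowded) with rarer c v crowded
    ... | b , b∈L , b-rarer =
      search (recolour c v b) (recolour-∈ L c∈L b∈L) (smaller (monoDegreeSum-recolour-< c v b b-rarer))

deg≤Δ : ∀ {n} (H : Graph n) v → deg H v ≤ Δ H
deg≤Δ H v = foldr-preservesᵒ (λ x y → [ m≤n⇒m≤n⊔o y , m≤n⇒m≤o⊔n x ]) 0 _
  (inj₂ (Any.map ≤-reflexive (∈-map⁺ (deg H) (∈-allFin v))))

δ≤deg : ∀ {m} (G : Graph (suc m)) u → δ G ≤ deg G u
δ≤deg G u = foldr-preservesᵒ (λ x y → [ m≤n⇒m⊓o≤n y , m≤n⇒o⊓m≤n x ]) (deg G fzero) _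
  (inj₂ (Any.map (λ e → ≤-reflexive (sym e)) (∈-map⁺ (deg G) (∈-allFin u))))

another-vertex : ∀ {m} (u : Fin (suc (suc m))) → ∃[ w ] u ≢ w
another-vertex fzero    = fsuc fzero , λ ()
another-vertex (fsuc _) = fzero , λ ()

first-edge : ∀ {n} {G : Graph n} {u w} → Reachable G u w → u ≢ w → ∃ (Adj G u)
first-edge here        u≢u = contradiction refl u≢u
first-edge (step ux _) _   = _ , ux

adjacent⇒1≤deg : ∀ {n} (G : Graph n) {u x} → Adj G u x → 1 ≤ deg G u
adjacent⇒1≤deg G {u} {x} ux with filter (adj? G u) (allFin _) | ∈-filter⁺ (adj? G u) (∈-allFin x) ux
... | _ ∷ _ | _ = s≤s z≤n

connected⇒1≤deg : ∀ {m} (G : Graph (suc (suc m))) → Connected G → ∀ u → 1 ≤ deg G u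
connected⇒1≤deg G connected u =
  let w , u≢w = another-vertex u in adjacent⇒1≤deg G (proj₂ (first-edge (connected u w) u≢w))

connected⇒1≤δ : ∀ {m} (G : Graph (suc (suc m))) → Connected G → 1 ≤ δ G
connected⇒1≤δ G connected =
  foldr-preservesᵇ {P = 1 ≤_} ⊓-glb (1≤deg fzero) (All.map⁺ (tabulate⁺ 1≤deg))
  where 1≤deg = connected⇒1≤deg G connected

m<[⌈m/n⌉+1]*n : ∀ m n → 1 ≤ n → m < (⌈ m / n ⌉ + 1) * n
m<[⌈m/n⌉+1]*n m (suc d) _ = ≰⇒> λ [q+1]*n≤m → <-irrefl refl (begin-strict
  q                        <⟨ m<m+n q z<s ⟩
  q + 1                    ≡⟨ m*n/n≡m (q + 1) (suc d) ⟨
  (q + 1) * suc d / suc d  ≤⟨ /-monoˡ-≤ (suc d) (≤-trans [q+1]*n≤m (m≤m+n m d)) ⟩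
  (m + d) / suc d          ∎)
  where
  open ≤-Reasoning
  q = (m + d) / suc d

monoCopy⇒δ≤monoDegree : ∀ {m n} (G : Graph (suc m)) (H : Graph n) c col →
  MonoCopy G H c col → ∃[ v ] δ G ≤ monoDegree H c v
monoCopy⇒δ≤monoDegree G H c col (f , f-inj , f-hom , f-col) = f fzero , (begin
  δ G                       ≤⟨ δ≤deg G fzero ⟩
  deg G fzero               ≡⟨ deg≡count G fzero ⟩
  count (adj? G fzero)      ≤⟨ injection⇒count≤count (adj? G fzero) (λ y → adj? H w y ×-dec c y ≟ c w) f-inj
                                 (λ {x} a → f-hom fzero x a , trans (f-col x) (sym (f-col fzero))) ⟩
  monoDegree H c w          ∎)
  where
  open ≤-Reasoning
  w = f fzero

theorem3 : ∀ {m n} (H : Graph n) (G : Graph m) →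
    Connected H → Connected G → 2 ≤ m →
    Choosable G H (⌈ Δ H / δ G ⌉ + 1)
theorem3 H G _ G-connected (s≤s (s≤s _)) L L-unique L-long =
  let c , c∈L , sparse = L-colouring-with-monoDegree< H L (δ G) rarer (proj₁ ∘ nonempty) (proj₂ ∘ nonempty)
  in c , c∈L , λ col copy →
       let v , δ≤ = monoCopy⇒δ≤monoDegree G H c col copy in <⇒≱ (sparse v) δ≤
  where
  rarer : ∀ c v → δ G ≤ monoDegree H c v → ∃[ b ] b ∈ L v × colourDegree H c v b < monoDegree H c v
  rarer c v δ≤ = rarer-colour H c v (L-unique v) (begin-strict
    deg H v                          ≤⟨ deg≤Δ H v ⟩
    Δ H                              <⟨ m<[⌈m/n⌉+1]*n (Δ H) (δ G) (connected⇒1≤δ G G-connected) ⟩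
    (⌈ Δ H / δ G ⌉ + 1) * δ G        ≤⟨ *-mono-≤ (L-long v) δ≤ ⟩
    length (L v) * monoDegree H c v  ∎)
    where open ≤-Reasoning
  nonempty : ∀ v → ∃[ a ] a ∈ L v
  nonempty v with L v | ≤-trans (m≤n+m 1 _) (L-long v)
  ... | a ∷ _ | _ = a , here refl
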